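{- Let $P$ be a finite poset and let $x$ be a maximal element of $P$ (respectively, a minimal element of $P$). Then the toggleability statistic $\mathfrak{T}_x$ is $0$-mesic under rowmotion on $\mathcal{IC}(P)$; that is, for every rowmotion orbit $\mathcal{O}\subseteq\mathcal{IC}(P)$, $\frac{1}{|\mathcal{O}|}\sum_{I\in\mathcal{O}}\mathfrak{T}_x(I)=0$.
   Context: Let $P$ be a finite poset. A subset $I\subseteq P$ is interval-closed if whenever $x,y\in I$ and $x\le z\le y$, then $z\in I$; $\mathcal{IC}(P)$ denotes the set of interval-closed subsets. For $x\in P$, the toggle $t_x:\mathcal{IC}(P)\to\mathcal{IC}(P)$ sends $I$ to $I\triangle\{x\}$ if this set is interval-closed, and to $I$ otherwise. Rowmotion is $\mathrm{Row}=t_{x_1}\circ\cdots\circ t_{x_N}$ for a linear extension $(x_1,\dots,x_N)$ of $P$ (independent of the choice); it is a bijection of $\mathcal{IC}(P)$ and its orbits partition $\mathcal{IC}(P)$. The toggleability statistic $\mathfrak{T}_x:\mathcal{IC}(P)\to\{ -1,0,1\}$ is $1$ if $x\notin I$ and $I\cup\{x\}$ is interval-closed, $-1$ if $x\in I$ and $I-\{x\}$ is interval-closed, and $0$ otherwise. A statistic is $c$-mesic if its average over every orbit equals $c$. -}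

module Defs where

open import Level using (0ℓ)
open import Data.Bool using (Bool; true; false; not)
open import Data.Nat using (ℕ; zero; suc)
open import Data.Fin using (Fin) renaming (_≤_ to _≤ᶠ_)
open import Data.Fin.Properties using (all?)
open import Data.Fin.Subset using (Subset; _∈_; _∉_; _∪_; _-_; ⁅_⁆)
open import Data.Fin.Subset.Properties using (_∈?_)
open import Data.Vec using (updateAt)
open import Data.List using (List; []; _∷_; map; allFin)
open import Data.Integer using (ℤ; +_; -[1+_]; _+_)
open import Data.Product using (_×_)
open import Function.Definitions using (Bijective)
open import Relation.Binary using (Rel; IsDecPartialOrder)
open import Relation.Binary.PropositionalEquality using (_≡_)
open import Relation.Nullary using (Dec; yes; no; _→-dec_)

module _ {n : ℕ} (_≤_ : Rel (Fin n) 0ℓ) (isPO : IsDecPartialOrder _≡_ _≤_) where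

  open IsDecPartialOrder isPO using (_≤?_)

  IntervalClosed : Subset n → Set
  IntervalClosed I = ∀ x y z → x ∈ I → y ∈ I → x ≤ z → z ≤ y → z ∈ I

  intervalClosed? : (I : Subset n) → Dec (IntervalClosed I)
  intervalClosed? I =
    all? λ x → all? λ y → all? λ z →
      (x ∈? I) →-dec ((y ∈? I) →-dec ((x ≤? z) →-dec ((z ≤? y) →-dec (z ∈? I))))

  flipAt : Fin n → Subset n → Subset n
  flipAt x I = updateAt I x not

  toggle : Fin n → Subset n → Subset n
  toggle x I with intervalClosed? (flipAt x I)
  ... | yes _ = flipAt x I
  ... | no  _ = I

  toggleSeq : List (Fin n) → Subset n → Subset n
  toggleSeq []       I = I
  toggleSeq (y ∷ ys) I = toggle y (toggleSeq ys I)

  IsLinearExtension : (Fin n → Fin n) → Set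
  IsLinearExtension σ =
    Bijective _≡_ _≡_ σ × (∀ i j → σ i ≤ σ j → i ≤ᶠ j)

  rowmotion : (Fin n → Fin n) → Subset n → Subset n
  rowmotion σ = toggleSeq (map σ (allFin n))

  rowmotionIter : (Fin n → Fin n) → ℕ → Subset n → Subset n
  rowmotionIter σ zero    I = I
  rowmotionIter σ (suc k) I = rowmotion σ (rowmotionIter σ k I)

  toggleability : Fin n → Subset n → ℤ
  toggleability x I with x ∈? I
  ... | no _ with intervalClosed? (I ∪ ⁅ x ⁆)
  ...   | yes _ = + 1
  ...   | no  _ = + 0
  toggleability x I | yes _ with intervalClosed? (I - x)
  ...   | yes _ = -[1+ 0 ]
  ...   | no  _ = + 0

  IsMaximal : Fin n → Set
  IsMaximal x = ∀ y → x ≤ y → y ≡ x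

  IsMinimal : Fin n → Set
  IsMinimal x = ∀ y → y ≤ x → y ≡ x

sumBelow : ℕ → (ℕ → ℤ) → ℤ
sumBelow zero    f = + 0
sumBelow (suc k) f = sumBelow k f + f k

module Submission where

-- Write [x ∈ J] for the indicator of x in J. For every J, 𝔗_x(J) = [x ∈ t_x J] − [x ∈ J], and t_x is an
-- involution on interval-closed sets. If x is maximal, 𝔗_x(J) depends only on J ∩ ↓x for interval-closed J;
-- if x is minimal, only on J ∩ ↑x (the dual statement). Rowmotion toggles, before t_x, elements that are not
-- below x and, after t_x, elements that are not above x; none of them changes [x ∈ J]. Hence
-- 𝔗_x(J) = [x ∈ Row J] − [x ∈ J] for x maximal and 𝔗_x(Row J) = [x ∈ J] − [x ∈ Row J] for x minimal,
-- and in both cases the sum over an orbit telescopes to 0.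

open import Defs
open import Level using (0ℓ)
open import Data.Nat using (ℕ; _<_; zero; suc)
open import Data.Nat.Base using (s≤s⁻¹)
open import Data.Bool using (true; false; not; if_then_else_)
open import Data.Bool.Properties using (not-involutive; ∨-identityʳ)
open import Data.Fin using (Fin; zero; suc) renaming (_≤_ to _≤ᶠ_)
open import Data.Fin.Subset using (Subset; _∈_; _∉_; _∪_; ⁅_⁆; inside; outside) renaming (_-_ to _∖_)
open import Data.Fin.Subset.Properties
  using (_∈?_; p─⊥≡p; ∪-identityʳ; x∈⁅x⁆; x∈⁅y⁆⇒x≡y; x∈p∪q⁺; x∈p∪q⁻; p─q⊆p; x∈p∧x∉q⇒x∈p─q; x≢y⇒x∉⁅y⁆)
open import Data.Vec using (_∷_; here; there; lookup; updateAt)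
open import Data.Vec.Properties
  using ([]=⇒lookup; lookup⇒[]=; lookup∘updateAt; lookup∘updateAt′; updateAt-updateAt-local; updateAt-id)
open import Data.List using (List; []; _∷_; _++_; map; allFin; tabulate)
open import Data.List.Properties using (map-tabulate)
open import Data.List.Relation.Unary.All using (All; []; _∷_)
open import Data.List.Relation.Unary.All.Properties using (tabulate⁺)
open import Data.Integer using (ℤ; +_; _+_; _-_)
open import Data.Integer.Properties using (+-identityˡ; +-identityʳ; +-inverseʳ; +-assoc; +-comm; +-0-abelianGroup)
open import Data.Integer.Tactic.RingSolver using (solve-∀)
open import Algebra.Properties.AbelianGroup +-0-abelianGroup using (∙-cancelˡ)
open import Data.Empty using (⊥-elim)
open import Data.Product using (_,_; proj₂)
open import Data.Sum using (_⊎_; inj₁; inj₂)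
import Data.Sum as Sum
open import Function using (_∘_; flip; id; case_of_)
open import Relation.Binary using (Rel; IsDecPartialOrder)
import Relation.Binary.Construct.Flip.EqAndOrd as Flip
open import Relation.Binary.PropositionalEquality
  using (_≡_; _≢_; refl; sym; trans; cong; cong₂; subst; subst₂; module ≡-Reasoning)
open import Relation.Nullary using (¬_; yes; no)

private variable
  n : ℕ
  x z : Fin n
  J K : Subset n

sumBelow-cong : ∀ k {f h : ℕ → ℤ} → (∀ j → f j ≡ h j) → sumBelow k f ≡ sumBelow k h
sumBelow-cong zero    f≗h = refl
sumBelow-cong (suc k) f≗h = cong₂ _+_ (sumBelow-cong k f≗h) (f≗h k)

sumBelow-telescope : ∀ (g : ℕ → ℤ) k → sumBelow k (λ j → g (suc j) - g j) ≡ g k - g 0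
sumBelow-telescope g zero    = sym (+-inverseʳ (g 0))
sumBelow-telescope g (suc k) =
  trans (cong (_+ (g (suc k) - g k)) (sumBelow-telescope g k)) (step (g 0) (g k) (g (suc k)))
  where
  step : ∀ a b c → (b - a) + (c - b) ≡ c - a
  step = solve-∀

sumBelow-telescope′ : ∀ (g : ℕ → ℤ) k → sumBelow k (λ j → g j - g (suc j)) ≡ g 0 - g k
sumBelow-telescope′ g zero    = sym (+-inverseʳ (g 0))
sumBelow-telescope′ g (suc k) =
  trans (cong (_+ (g k - g (suc k))) (sumBelow-telescope′ g k)) (step (g 0) (g k) (g (suc k)))
  where
  step : ∀ a b c → (a - b) + (b - c) ≡ a - c
  step = solve-∀

sumBelow-suc : ∀ (h : ℕ → ℤ) k → sumBelow (suc k) h ≡ h 0 + sumBelow k (h ∘ suc)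
sumBelow-suc h zero    = trans (+-identityˡ (h 0)) (sym (+-identityʳ (h 0)))
sumBelow-suc h (suc k) = trans (cong (_+ h (suc k)) (sumBelow-suc h k)) (+-assoc (h 0) _ (h (suc k)))

sumBelow-rotate : ∀ (h : ℕ → ℤ) k → h k ≡ h 0 → sumBelow k (h ∘ suc) ≡ sumBelow k h
sumBelow-rotate h k hk≡h0 = ∙-cancelˡ (h 0) _ _ (begin
  h 0 + sumBelow k (h ∘ suc) ≡⟨ sumBelow-suc h k ⟨
  sumBelow k h + h k         ≡⟨ cong (λ t → sumBelow k h + t) hk≡h0 ⟩
  sumBelow k h + h 0         ≡⟨ +-comm (sumBelow k h) (h 0) ⟩
  h 0 + sumBelow k h         ∎)
  where open ≡-Reasoning

∈-resp-lookup : lookup J z ≡ lookup K z → z ∈ J → z ∈ K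
∈-resp-lookup {J = J} {z = z} {K = K} eq z∈J = lookup⇒[]= z K (trans (sym eq) ([]=⇒lookup z∈J))

∪⁅⁆-∈ˡ : z ∈ J → z ∈ J ∪ ⁅ x ⁆
∪⁅⁆-∈ˡ z∈J = x∈p∪q⁺ (inj₁ z∈J)

∪⁅⁆-∈ʳ : z ≡ x → z ∈ J ∪ ⁅ x ⁆
∪⁅⁆-∈ʳ {x = x} refl = x∈p∪q⁺ (inj₂ (x∈⁅x⁆ x))

∪⁅⁆-∈⁻ : z ∈ J ∪ ⁅ x ⁆ → z ∈ J ⊎ z ≡ x
∪⁅⁆-∈⁻ {J = J} {x = x} = Sum.map₂ (x∈⁅y⁆⇒x≡y x) ∘ x∈p∪q⁻ J ⁅ x ⁆

∖-∈⁺ : z ∈ J → z ≢ x → z ∈ J ∖ x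
∖-∈⁺ z∈J z≢x = x∈p∧x∉q⇒x∈p─q z∈J (x≢y⇒x∉⁅y⁆ z≢x)

∖-∈⁻ : z ∈ J ∖ x → z ∈ J
∖-∈⁻ {J = J} {x = x} = p─q⊆p J ⁅ x ⁆

updateAt-not-∈ : x ∈ J → updateAt J x not ≡ J ∖ x
updateAt-not-∈ {x = zero}  {J = inside ∷ J} _         = cong (outside ∷_) (sym (p─⊥≡p J))
updateAt-not-∈ {x = suc x} {J = b ∷ J}      (there p) = cong (b ∷_) (updateAt-not-∈ p)

updateAt-not-∉ : x ∉ J → updateAt J x not ≡ J ∪ ⁅ x ⁆
updateAt-not-∉ {x = zero}  {J = outside ∷ J} _   = cong (inside ∷_) (sym (∪-identityʳ J))
updateAt-not-∉ {x = zero}  {J = inside ∷ J}  x∉J = ⊥-elim (x∉J here)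
updateAt-not-∉ {x = suc x} {J = b ∷ J}       x∉J =
  cong₂ _∷_ (sym (∨-identityʳ b)) (updateAt-not-∉ (x∉J ∘ there))

updateAt-not-involutive : ∀ (x : Fin n) J → updateAt (updateAt J x not) x not ≡ J
updateAt-not-involutive x J = trans (updateAt-updateAt-local x J (not-involutive _)) (updateAt-id x J)

∈-updateAt-not : x ∉ J → x ∈ updateAt J x not
∈-updateAt-not {x = zero}  {J = outside ∷ J} _   = here
∈-updateAt-not {x = zero}  {J = inside ∷ J}  x∉J = ⊥-elim (x∉J here)
∈-updateAt-not {x = suc x} {J = b ∷ J}       x∉J = there (∈-updateAt-not (x∉J ∘ there))

∉-updateAt-not : x ∈ J → x ∉ updateAt J x not
∉-updateAt-not {x = suc x} {J = b ∷ J} (there x∈J) (there x∈J′) = ∉-updateAt-not x∈J x∈J′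

∖-∈⇒≢ : z ∈ J ∖ x → z ≢ x
∖-∈⇒≢ x∈J∖x refl =
  ∉-updateAt-not (∖-∈⁻ x∈J∖x) (subst (_ ∈_) (sym (updateAt-not-∈ (∖-∈⁻ x∈J∖x))) x∈J∖x)

indicator : Fin n → Subset n → ℤ
indicator x J = if lookup J x then + 1 else + 0

indicator-∈ : x ∈ J → indicator x J ≡ + 1
indicator-∈ x∈J rewrite []=⇒lookup x∈J = refl

indicator-∉ : x ∉ J → indicator x J ≡ + 0
indicator-∉ {x = x} {J = J} x∉J with lookup J x in eq
... | true  = ⊥-elim (x∉J (lookup⇒[]= x J eq))
... | false = refl

indicator-cong : ∀ J K → lookup J x ≡ lookup K x → indicator x J ≡ indicator x K
indicator-cong _ _ = cong (λ b → if b then + 1 else + 0)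

AgreeOn : (Fin n → Set) → Subset n → Subset n → Set
AgreeOn C J K = ∀ z → C z → lookup J z ≡ lookup K z

module Toggling {n : ℕ} (_≤_ : Rel (Fin n) 0ℓ) (isPO : IsDecPartialOrder _≡_ _≤_) where

  open IsDecPartialOrder isPO using () renaming (refl to ≤-refl; trans to ≤-trans)

  private
    IC = IntervalClosed _≤_ isPO
    ic? = intervalClosed? _≤_ isPO
    tog = toggle _≤_ isPO
    tseq = toggleSeq _≤_ isPO
    𝔗 = toggleability _≤_ isPO

  isDecPartialOrder-op : IsDecPartialOrder _≡_ (flip _≤_)
  isDecPartialOrder-op = record
    { isPartialOrder = Flip.isPartialOrder (IsDecPartialOrder.isPartialOrder isPO)
    ; _≟_            = IsDecPartialOrder._≟_ isPO
    ; _≤?_           = flip (IsDecPartialOrder._≤?_ isPO)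
    }

  IntervalClosed-op : IC J → IntervalClosed (flip _≤_) isDecPartialOrder-op J
  IntervalClosed-op icJ p q z p∈J q∈J z≤p q≤z = icJ q p z q∈J p∈J q≤z z≤p

  IntervalClosed-unop : IntervalClosed (flip _≤_) isDecPartialOrder-op J → IC J
  IntervalClosed-unop icJ p q z p∈J q∈J p≤z z≤q = icJ q p z q∈J p∈J z≤q p≤z

  toggle-flip : ∀ x J → IC (updateAt J x not) → tog x J ≡ updateAt J x not
  toggle-flip x J ic with ic? (updateAt J x not)
  ... | yes _  = refl
  ... | no ¬ic = ⊥-elim (¬ic ic)

  toggle-stay : ∀ x J → ¬ IC (updateAt J x not) → tog x J ≡ J
  toggle-stay x J ¬ic with ic? (updateAt J x not)
  ... | yes ic = ⊥-elim (¬ic ic)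
  ... | no _   = refl

  toggle-IC : ∀ y {J} → IC J → IC (tog y J)
  toggle-IC y {J} icJ with ic? (updateAt J y not)
  ... | yes ic = ic
  ... | no _   = icJ

  toggle-involutive : ∀ x J → IC J → tog x (tog x J) ≡ J
  toggle-involutive x J icJ with ic? (updateAt J x not)
  ... | yes _  = trans (toggle-flip x _ (subst IC (sym (updateAt-not-involutive x J)) icJ))
                       (updateAt-not-involutive x J)
  ... | no ¬ic = toggle-stay x J ¬ic

  toggle-lookup-≢ : ∀ y J → z ≢ y → lookup (tog y J) z ≡ lookup J z
  toggle-lookup-≢ {z = z} y J z≢y with ic? (updateAt J y not)
  ... | yes _ = lookup∘updateAt′ z y z≢y J
  ... | no _  = refl

  toggle-lookup-cong : ∀ x J K → (IC (updateAt J x not) → IC (updateAt K x not)) →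
                       (IC (updateAt K x not) → IC (updateAt J x not)) →
                       lookup J x ≡ lookup K x → lookup (tog x J) x ≡ lookup (tog x K) x
  toggle-lookup-cong x J K J⇒K K⇒J eq with ic? (updateAt J x not) | ic? (updateAt K x not)
  ... | yes _   | yes _   = trans (lookup∘updateAt x J) (trans (cong not eq) (sym (lookup∘updateAt x K)))
  ... | yes icJ | no ¬icK = ⊥-elim (¬icK (J⇒K icJ))
  ... | no ¬icJ | yes icK = ⊥-elim (¬icJ (K⇒J icK))
  ... | no _    | no _    = eq

  toggleSeq-IC : ∀ ys {J} → IC J → IC (tseq ys J)
  toggleSeq-IC []       icJ = icJ
  toggleSeq-IC (y ∷ ys) icJ = toggle-IC y (toggleSeq-IC ys icJ)

  toggleSeq-++ : ∀ ys zs J → tseq (ys ++ zs) J ≡ tseq ys (tseq zs J)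
  toggleSeq-++ []       zs J = refl
  toggleSeq-++ (y ∷ ys) zs J = cong (tog y) (toggleSeq-++ ys zs J)

  toggleSeq-agree : ∀ {C : Fin n → Set} ys J → All (¬_ ∘ C) ys → AgreeOn C (tseq ys J) J
  toggleSeq-agree []       J []           z Cz = refl
  toggleSeq-agree (y ∷ ys) J (¬Cy ∷ ¬Cys) z Cz =
    trans (toggle-lookup-≢ y (tseq ys J) (λ { refl → ¬Cy Cz })) (toggleSeq-agree ys J ¬Cys z Cz)

  toggleability-toggle : ∀ x J → 𝔗 x J ≡ indicator x (tog x J) - indicator x J
  toggleability-toggle x J with x ∈? J
  ... | yes x∈J with ic? (J ∖ x)
  ...   | yes ic rewrite toggle-flip x J (subst IC (sym (updateAt-not-∈ x∈J)) ic)
                       | indicator-∉ (∉-updateAt-not x∈J) | indicator-∈ x∈J = refl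
  ...   | no ¬ic rewrite toggle-stay x J (¬ic ∘ subst IC (updateAt-not-∈ x∈J)) =
                   sym (+-inverseʳ (indicator x J))
  toggleability-toggle x J | no x∉J with ic? (J ∪ ⁅ x ⁆)
  ...   | yes ic rewrite toggle-flip x J (subst IC (sym (updateAt-not-∉ x∉J)) ic)
                       | indicator-∈ (∈-updateAt-not x∉J) | indicator-∉ x∉J = refl
  ...   | no ¬ic rewrite toggle-stay x J (¬ic ∘ subst IC (updateAt-not-∉ x∉J)) =
                   sym (+-inverseʳ (indicator x J))

  toggleability-cong : ∀ x J K → (IC (updateAt J x not) → IC (updateAt K x not)) →
                       (IC (updateAt K x not) → IC (updateAt J x not)) →
                       lookup J x ≡ lookup K x → 𝔗 x J ≡ 𝔗 x K
  toggleability-cong x J K J⇒K K⇒J eq = begin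
    𝔗 x J                                  ≡⟨ toggleability-toggle x J ⟩
    indicator x (tog x J) - indicator x J  ≡⟨ cong₂ _-_ (indicator-cong (tog x J) (tog x K) toggled-eq)
                                                        (indicator-cong J K eq) ⟩
    indicator x (tog x K) - indicator x K  ≡⟨ toggleability-toggle x K ⟨
    𝔗 x K                                  ∎
    where
    open ≡-Reasoning
    toggled-eq = toggle-lookup-cong x J K J⇒K K⇒J eq

  ∖-maximal-IC : IsMaximal _≤_ isPO x → IC J → IC (J ∖ x)
  ∖-maximal-IC max icJ p q z p∈ q∈ p≤z z≤q =
    ∖-∈⁺ (icJ p q z (∖-∈⁻ p∈) (∖-∈⁻ q∈) p≤z z≤q) (λ { refl → ∖-∈⇒≢ q∈ (max q z≤q) })

  ∪⁅⁆-IC-transfer : IsMaximal _≤_ isPO x → IC K → AgreeOn (_≤ x) J K → IC (J ∪ ⁅ x ⁆) → IC (K ∪ ⁅ x ⁆)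
  ∪⁅⁆-IC-transfer {x = x} {K = K} {J = J} max icK agree icJx p q z p∈ q∈ p≤z z≤q
    with ∪⁅⁆-∈⁻ {J = K} p∈ | ∪⁅⁆-∈⁻ {J = K} q∈
  ... | inj₂ refl | _        = ∪⁅⁆-∈ʳ (max z p≤z)
  ... | inj₁ p∈K  | inj₁ q∈K = ∪⁅⁆-∈ˡ (icK p q z p∈K q∈K p≤z z≤q)
  ... | inj₁ p∈K  | inj₂ refl with ∪⁅⁆-∈⁻ {J = J} (icJx p x z p∈J∪x (∪⁅⁆-∈ʳ refl) p≤z z≤q)
    where p∈J∪x = ∪⁅⁆-∈ˡ (∈-resp-lookup (sym (agree p (≤-trans p≤z z≤q))) p∈K)
  ...   | inj₁ z∈J = ∪⁅⁆-∈ˡ (∈-resp-lookup (agree z z≤q) z∈J)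
  ...   | inj₂ z≡x = ∪⁅⁆-∈ʳ z≡x

  flip-IC-transfer : IsMaximal _≤_ isPO x → IC J → IC K → AgreeOn (_≤ x) J K →
                     IC (updateAt J x not) → IC (updateAt K x not)
  flip-IC-transfer {x = x} {J = J} max icJ icK agree icJ′ with x ∈? J
  ... | yes x∈J = subst IC (sym (updateAt-not-∈ (∈-resp-lookup (agree x ≤-refl) x∈J))) (∖-maximal-IC max icK)
  ... | no x∉J  = subst IC (sym (updateAt-not-∉ (x∉J ∘ ∈-resp-lookup (sym (agree x ≤-refl)))))
                    (∪⁅⁆-IC-transfer max icK agree (subst IC (updateAt-not-∉ x∉J) icJ′))

  toggleability-agree-below : IsMaximal _≤_ isPO x → IC J → IC K → AgreeOn (_≤ x) J K → 𝔗 x J ≡ 𝔗 x K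
  toggleability-agree-below {x = x} {J = J} {K = K} max icJ icK agree =
    toggleability-cong x J K (flip-IC-transfer max icJ icK agree)
                             (flip-IC-transfer max icK icJ (λ z z≤x → sym (agree z z≤x))) (agree x ≤-refl)

module _ {n : ℕ} (_≤_ : Rel (Fin n) 0ℓ) (isPO : IsDecPartialOrder _≡_ _≤_) where

  open IsDecPartialOrder isPO using () renaming (refl to ≤-refl)
  open Toggling _≤_ isPO

  private
    IC = IntervalClosed _≤_ isPO
    tog = toggle _≤_ isPO
    tseq = toggleSeq _≤_ isPO
    𝔗 = toggleability _≤_ isPO

  toggleability-agree-above : IsMinimal _≤_ isPO x → IC J → IC K → AgreeOn (x ≤_) J K → 𝔗 x J ≡ 𝔗 x K
  toggleability-agree-above {x = x} {J = J} {K = K} min icJ icK agree =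
    toggleability-cong x J K (transfer icJ icK agree) (transfer icK icJ (λ z x≤z → sym (agree z x≤z)))
                             (agree x ≤-refl)
    where
    transfer : ∀ {A B} → IC A → IC B → AgreeOn (x ≤_) A B → IC (updateAt A x not) → IC (updateAt B x not)
    transfer icA icB agreeAB =
      IntervalClosed-unop
      ∘ Toggling.flip-IC-transfer (flip _≤_) isDecPartialOrder-op min
          (IntervalClosed-op icA) (IntervalClosed-op icB) agreeAB
      ∘ IntervalClosed-op

  record Split (x : Fin n) (xs : List (Fin n)) : Set where
    field
      before after     : List (Fin n)
      splits           : xs ≡ before ++ x ∷ after
      before-not-above : All (λ y → ¬ x ≤ y) before
      after-not-below  : All (λ y → ¬ y ≤ x) after

  tabulate-split : ∀ {m} (f : Fin m → Fin n) → (∀ i j → f i ≤ f j → i ≤ᶠ j) → ∀ i → Split (f i) (tabulate f)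
  tabulate-split f reflects zero = record
    { before           = []
    ; after            = tabulate (f ∘ suc)
    ; splits           = refl
    ; before-not-above = []
    ; after-not-below  = tabulate⁺ (λ j fj≤f0 → case reflects (suc j) zero fj≤f0 of λ ())
    }
  tabulate-split f reflects (suc i) = record
    { before           = f zero ∷ before
    ; after            = after
    ; splits           = cong (f zero ∷_) splits
    ; before-not-above = (λ fi≤f0 → case reflects (suc i) zero fi≤f0 of λ ()) ∷ before-not-above
    ; after-not-below  = after-not-below
    }
    where open Split (tabulate-split (f ∘ suc) (λ i j fi≤fj → s≤s⁻¹ (reflects (suc i) (suc j) fi≤fj)) i)

  linearExtension-split : ∀ {σ} → IsLinearExtension _≤_ isPO σ → ∀ x → Split x (map σ (allFin n))
  linearExtension-split {σ} (bijective , reflects) x with proj₂ bijective x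
  ... | i , σi≡x = subst₂ Split (σi≡x refl) (sym (map-tabulate id σ)) (tabulate-split σ reflects i)

  module _ {σ : Fin n → Fin n} {x : Fin n} (split : Split x (map σ (allFin n))) where

    open Split split

    private
      row = rowmotion _≤_ isPO σ
      iter = rowmotionIter _≤_ isPO σ

    rowmotion-split : ∀ J → row J ≡ tseq before (tog x (tseq after J))
    rowmotion-split J = trans (cong (λ xs → tseq xs J) splits) (toggleSeq-++ before (x ∷ after) J)

    indicator-before : ∀ J → indicator x (tseq before J) ≡ indicator x J
    indicator-before J = indicator-cong (tseq before J) J (toggleSeq-agree before J before-not-above x ≤-refl)

    indicator-after : ∀ J → indicator x (tseq after J) ≡ indicator x J
    indicator-after J = indicator-cong (tseq after J) J (toggleSeq-agree after J after-not-below x ≤-refl)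

    toggleability-maximal : IsMaximal _≤_ isPO x → IC J → 𝔗 x J ≡ indicator x (row J) - indicator x J
    toggleability-maximal {J = J} max icJ = begin
      𝔗 x J
        ≡⟨ toggleability-agree-below max icJ (toggleSeq-IC after icJ) J≈Jₐ ⟩
      𝔗 x Jₐ
        ≡⟨ toggleability-toggle x Jₐ ⟩
      indicator x (tog x Jₐ) - indicator x Jₐ
        ≡⟨ cong₂ _-_ (indicator-before (tog x Jₐ)) (sym (indicator-after J)) ⟨
      indicator x (tseq before (tog x Jₐ)) - indicator x J
        ≡⟨ cong (λ L → indicator x L - indicator x J) (rowmotion-split J) ⟨
      indicator x (row J) - indicator x J
        ∎
      where
      open ≡-Reasoning
      Jₐ = tseq after J
      J≈Jₐ : AgreeOn (_≤ x) J Jₐ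
      J≈Jₐ z z≤x = sym (toggleSeq-agree after J after-not-below z z≤x)

    toggleability-minimal : IsMinimal _≤_ isPO x → IC J → 𝔗 x (row J) ≡ indicator x J - indicator x (row J)
    toggleability-minimal {J = J} min icJ = begin
      𝔗 x (row J)
        ≡⟨ cong (𝔗 x) (rowmotion-split J) ⟩
      𝔗 x (tseq before Jₓ)
        ≡⟨ toggleability-agree-above min (toggleSeq-IC before icJₓ) icJₓ
             (toggleSeq-agree before Jₓ before-not-above) ⟩
      𝔗 x Jₓ
        ≡⟨ toggleability-toggle x Jₓ ⟩
      indicator x (tog x Jₓ) - indicator x Jₓ
        ≡⟨ cong₂ _-_ (cong (indicator x) (toggle-involutive x Jₐ icJₐ)) (sym (indicator-before Jₓ)) ⟩
      indicator x Jₐ - indicator x (tseq before Jₓ)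
        ≡⟨ cong₂ _-_ (indicator-after J) (cong (indicator x) (sym (rowmotion-split J))) ⟩
      indicator x J - indicator x (row J)
        ∎
      where
      open ≡-Reasoning
      Jₐ = tseq after J
      icJₐ = toggleSeq-IC after icJ
      Jₓ = tog x Jₐ
      icJₓ = toggle-IC x icJₐ

    rowmotionIter-IC : ∀ j {I} → IC I → IC (iter j I)
    rowmotionIter-IC zero    icI = icI
    rowmotionIter-IC (suc j) icI = toggleSeq-IC (map σ (allFin n)) (rowmotionIter-IC j icI)

    orbitSum-maximal : IsMaximal _≤_ isPO x → ∀ {I} → IC I → ∀ k → iter k I ≡ I →
                       sumBelow k (λ j → 𝔗 x (iter j I)) ≡ + 0
    orbitSum-maximal max {I} icI k periodic = begin
      sumBelow k (λ j → 𝔗 x (iter j I))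
        ≡⟨ sumBelow-cong k (λ j → toggleability-maximal max (rowmotionIter-IC j icI)) ⟩
      sumBelow k (λ j → g (suc j) - g j)
        ≡⟨ sumBelow-telescope g k ⟩
      g k - g 0
        ≡⟨ cong (λ L → indicator x L - g 0) periodic ⟩
      g 0 - g 0
        ≡⟨ +-inverseʳ (g 0) ⟩
      + 0
        ∎
      where
      open ≡-Reasoning
      g : ℕ → ℤ
      g j = indicator x (iter j I)

    orbitSum-minimal : IsMinimal _≤_ isPO x → ∀ {I} → IC I → ∀ k → iter k I ≡ I →
                       sumBelow k (λ j → 𝔗 x (iter j I)) ≡ + 0
    orbitSum-minimal min {I} icI k periodic = begin
      sumBelow k (λ j → 𝔗 x (iter j I))
        ≡⟨ sumBelow-rotate (λ j → 𝔗 x (iter j I)) k (cong (𝔗 x) periodic) ⟨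
      sumBelow k (λ j → 𝔗 x (iter (suc j) I))
        ≡⟨ sumBelow-cong k (λ j → toggleability-minimal min (rowmotionIter-IC j icI)) ⟩
      sumBelow k (λ j → g j - g (suc j))
        ≡⟨ sumBelow-telescope′ g k ⟩
      g 0 - g k
        ≡⟨ cong (λ L → g 0 - indicator x L) periodic ⟩
      g 0 - g 0
        ≡⟨ +-inverseʳ (g 0) ⟩
      + 0
        ∎
      where
      open ≡-Reasoning
      g : ℕ → ℤ
      g j = indicator x (iter j I)

proposition2p26 : (n : ℕ) (_≤_ : Rel (Fin n) 0ℓ) (isPO : IsDecPartialOrder _≡_ _≤_)
  (x : Fin n) → IsMaximal _≤_ isPO x ⊎ IsMinimal _≤_ isPO x →
  (σ : Fin n → Fin n) → IsLinearExtension _≤_ isPO σ →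
  (I : Subset n) → IntervalClosed _≤_ isPO I →
  (k : ℕ) → 0 < k → rowmotionIter _≤_ isPO σ k I ≡ I →
  (∀ j → 0 < j → j < k → rowmotionIter _≤_ isPO σ j I ≢ I) →
  sumBelow k (λ j → toggleability _≤_ isPO x (rowmotionIter _≤_ isPO σ j I)) ≡ + 0
proposition2p26 n _≤_ isPO x (inj₁ max) σ lin I icI k _ periodic _ =
  orbitSum-maximal _≤_ isPO (linearExtension-split _≤_ isPO lin x) max icI k periodic
proposition2p26 n _≤_ isPO x (inj₂ min) σ lin I icI k _ periodic _ =
  orbitSum-minimal _≤_ isPO (linearExtension-split _≤_ isPO lin x) min icI k periodic
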